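{- For every even integer $n>5$, $$\left\lceil\frac{n+14}{4}\right\rceil\le g^4(C_n)\le \frac{n}{2}+3.$$
   Context: $C_n$ denotes the cyclic group of order $n$. For a finite abelian group $G$ (written additively) and a positive integer $k$, the $k$-Harborth constant $g^k(G)$ is the smallest positive integer $t$ such that every subset $S\subseteq G$ with $|S|\ge t$ contains a subset $T$ with $|T|=k$ and $\sum_{x\in T}x=0$. -}

module Defs where

open import Data.Nat using (ℕ; _≤_; _+_)
open import Data.Nat.Divisibility using (_∣_)
open import Data.Bool using (if_then_else_)
open import Data.Fin using (Fin; toℕ)
open import Data.Fin.Subset using (Subset; _⊆_; ∣_∣; _∈_)
open import Data.Vec using (lookup)
open import Data.List using (map; allFin)
open import Data.Nat.ListAction using (sum)
open import Data.Product using (Σ; _×_)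
open import Data.Bool using (Bool)
open import Relation.Binary.PropositionalEquality using (_≡_)

-- The cyclic group C_n is modelled as ℤ/nℤ with carrier Fin n = {0,…,n-1},
-- addition modulo n.  A subset of C_n is a 'Subset n' (characteristic vector).

subsetSum : ∀ {n} → Subset n → ℕ
subsetSum {n} T = sum (map (λ i → if lookup T i then toℕ i else 0) (allFin n))

ZeroSum : ∀ {n} → Subset n → Set
ZeroSum {n} T = n ∣ subsetSum T

HarborthProp : ℕ → ℕ → ℕ → Set
HarborthProp n k t =
  (S : Subset n) → t ≤ ∣ S ∣ → Σ (Subset n) (λ T → T ⊆ S × ∣ T ∣ ≡ k × ZeroSum T)

IsHarborthConstant : ℕ → ℕ → ℕ → Set
IsHarborthConstant n k g =
  1 ≤ g × HarborthProp n k g × ((t : ℕ) → 1 ≤ t → HarborthProp n k t → g ≤ t)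

-- Lower bound: read as integers in [0, n), four distinct elements of the interval
-- {x, …, x+k−1} sum to at least 4x+6 and at most 4(x+k)−10; when these bounds lie strictly
-- between n and 2n, no four of them sum to a multiple of n, so every t with the Harborth
-- property exceeds k.  Writing n = 2(2r+2+e) with e ≤ 1, the interval starting at r+e with
-- r+4 elements qualifies, giving g ≥ r+5 = ⌈(n+14)/4⌉.
--
-- Upper bound: for n = 2m, the elements other than 0 and m fall into the m−1 pairs {j, n−j}.
-- A set of m+3 elements has at least m+1 elements outside {0, m}, hence contains two whole
-- pairs, whose four elements sum to 2n.  The pairs are found by peeling off the outermost
-- pair {1, n−1}: either both of its elements lie in the set, or at most one does and the
-- inner pairs still carry enough elements.
module Submission where

open import Defs
open import Data.Bool using (if_then_else_; _∨_)
open import Data.Fin using (Fin; zero; suc; toℕ; inject₁; fromℕ)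
import Data.Fin.Properties as Fin
open import Data.Fin.Subset
open import Data.Fin.Subset.Properties
import Data.List as List
import Data.List.Properties as List
open import Data.Nat using (ℕ; zero; suc; _+_; _*_; _≤_; _<_; z≤n; s≤s; s≤s⁻¹; s<s⁻¹; _≤?_)
open import Data.Nat.Combinatorics using (_C_; nCk+nC[k+1]≡[n+1]C[k+1]; nC1≡n)
open import Data.Nat.DivMod using (_/_; _%_; m≡m%n+[m/n]*n; m%n<n; m<n*o⇒m/o<n; m*n/n≡m)
open import Data.Nat.Divisibility using (_∣_; divides)
open import Data.Nat.ListAction using (sum)
open import Data.Nat.Properties
open import Algebra.Properties.CommutativeSemigroup +-commutativeSemigroup using (interchange)
open import Data.Nat.Tactic.RingSolver using (solve-∀)
open import Data.Product using (Σ; _×_; _,_; proj₁; proj₂; map)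
open import Data.Sum using ([_,_]′)
open import Data.Vec using ([]; _∷_; _∷ʳ_; lookup; initLast; here; there)
open import Function using (_∘_)
open import Relation.Binary.PropositionalEquality
open import Relation.Nullary using (¬_; yes; no; contradiction)

weightedSum : ∀ {n} → (Fin n → ℕ) → Subset n → ℕ
weightedSum {n} w T = sum (List.map (λ i → if lookup T i then w i else 0) (List.allFin n))

weightedSum-∷ : ∀ {n} (w : Fin (suc n) → ℕ) b (T : Subset n) →
  weightedSum w (b ∷ T) ≡ (if b then w zero else 0) + weightedSum (w ∘ suc) T
weightedSum-∷ w b T =
  cong (_ +_) (cong sum (trans (List.map-tabulate suc term)
                              (sym (List.map-tabulate (λ i → i) (term ∘ suc)))))
  where
  term : Fin _ → ℕ
  term i = if lookup (b ∷ T) i then w i else 0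

weightedSum-⊥ : ∀ {n} (w : Fin n → ℕ) → weightedSum w ⊥ ≡ 0
weightedSum-⊥ {zero}  w = refl
weightedSum-⊥ {suc n} w = trans (weightedSum-∷ w outside ⊥) (weightedSum-⊥ (w ∘ suc))

weightedSum-⁅⁆ : ∀ {n} (w : Fin n → ℕ) i → weightedSum w ⁅ i ⁆ ≡ w i
weightedSum-⁅⁆ w zero    = begin
  weightedSum w (inside ∷ ⊥)     ≡⟨ weightedSum-∷ w inside ⊥ ⟩
  w zero + weightedSum (w ∘ suc) ⊥ ≡⟨ cong (w zero +_) (weightedSum-⊥ (w ∘ suc)) ⟩
  w zero + 0                     ≡⟨ +-identityʳ (w zero) ⟩
  w zero                         ∎
  where open ≡-Reasoning
weightedSum-⁅⁆ w (suc i) = trans (weightedSum-∷ w outside ⁅ i ⁆) (weightedSum-⁅⁆ (w ∘ suc) i)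

weightedSum-+ : ∀ {n} (f g : Fin n → ℕ) (T : Subset n) →
  weightedSum (λ i → f i + g i) T ≡ weightedSum f T + weightedSum g T
weightedSum-+ f g []      = refl
weightedSum-+ f g (b ∷ T) = begin
  weightedSum (λ i → f i + g i) (b ∷ T)
    ≡⟨ weightedSum-∷ (λ i → f i + g i) b T ⟩
  (if b then f zero + g zero else 0) + weightedSum (λ i → f (suc i) + g (suc i)) T
    ≡⟨ cong₂ _+_ (if-+ b) (weightedSum-+ (f ∘ suc) (g ∘ suc) T) ⟩
  (f₀ + g₀) + (weightedSum (f ∘ suc) T + weightedSum (g ∘ suc) T)
    ≡⟨ interchange f₀ g₀ (weightedSum (f ∘ suc) T) (weightedSum (g ∘ suc) T) ⟩
  (f₀ + weightedSum (f ∘ suc) T) + (g₀ + weightedSum (g ∘ suc) T)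
    ≡⟨ sym (cong₂ _+_ (weightedSum-∷ f b T) (weightedSum-∷ g b T)) ⟩
  weightedSum f (b ∷ T) + weightedSum g (b ∷ T) ∎
  where
  open ≡-Reasoning
  f₀ g₀ : ℕ
  f₀ = if b then f zero else 0
  g₀ = if b then g zero else 0
  if-+ : ∀ b → (if b then f zero + g zero else 0) ≡ (if b then f zero else 0) + (if b then g zero else 0)
  if-+ inside  = refl
  if-+ outside = refl

weightedSum-∪ : ∀ {n} (w : Fin n → ℕ) {p q : Subset n} → Empty (p ∩ q) →
  weightedSum w (p ∪ q) ≡ weightedSum w p + weightedSum w q
weightedSum-∪ w {[]}    {[]}    _        = refl
weightedSum-∪ w {s ∷ p} {t ∷ q} disjoint = begin
  weightedSum w ((s ∨ t) ∷ (p ∪ q))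
    ≡⟨ weightedSum-∷ w (s ∨ t) (p ∪ q) ⟩
  (if s ∨ t then w zero else 0) + weightedSum (w ∘ suc) (p ∪ q)
    ≡⟨ cong₂ _+_ (if-∨ s t disjoint) (weightedSum-∪ (w ∘ suc) (drop-∷-Empty disjoint)) ⟩
  (wₛ + wₜ) + (weightedSum (w ∘ suc) p + weightedSum (w ∘ suc) q)
    ≡⟨ interchange wₛ wₜ (weightedSum (w ∘ suc) p) (weightedSum (w ∘ suc) q) ⟩
  (wₛ + weightedSum (w ∘ suc) p) + (wₜ + weightedSum (w ∘ suc) q)
    ≡⟨ sym (cong₂ _+_ (weightedSum-∷ w s p) (weightedSum-∷ w t q)) ⟩
  weightedSum w (s ∷ p) + weightedSum w (t ∷ q) ∎
  where
  open ≡-Reasoning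
  wₛ wₜ : ℕ
  wₛ = if s then w zero else 0
  wₜ = if t then w zero else 0
  if-∨ : ∀ s t → Empty ((s ∷ p) ∩ (t ∷ q)) →
    (if s ∨ t then w zero else 0) ≡ (if s then w zero else 0) + (if t then w zero else 0)
  if-∨ inside  inside  disjoint = contradiction (zero , here) disjoint
  if-∨ inside  outside _        = sym (+-identityʳ (w zero))
  if-∨ outside t       _        = refl

∣p∣≡weightedSum : ∀ {n} (T : Subset n) → ∣ T ∣ ≡ weightedSum (λ _ → 1) T
∣p∣≡weightedSum []            = refl
∣p∣≡weightedSum (inside ∷ T)  =
  trans (cong suc (∣p∣≡weightedSum T)) (sym (weightedSum-∷ (λ _ → 1) inside T))
∣p∣≡weightedSum (outside ∷ T) = trans (∣p∣≡weightedSum T) (sym (weightedSum-∷ (λ _ → 1) outside T))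

subsetSum-∷ : ∀ {n} b (T : Subset n) → subsetSum (b ∷ T) ≡ ∣ T ∣ + subsetSum T
subsetSum-∷ b T = begin
  subsetSum (b ∷ T)
    ≡⟨ weightedSum-∷ toℕ b T ⟩
  (if b then 0 else 0) + weightedSum (λ i → 1 + toℕ i) T
    ≡⟨ cong₂ _+_ (if-0 b) (weightedSum-+ (λ _ → 1) toℕ T) ⟩
  weightedSum (λ _ → 1) T + subsetSum T
    ≡⟨ cong (_+ subsetSum T) (∣p∣≡weightedSum T) ⟨
  ∣ T ∣ + subsetSum T ∎
  where
  open ≡-Reasoning
  if-0 : ∀ b → (if b then 0 else 0) ≡ 0
  if-0 inside  = refl
  if-0 outside = refl

weightedSum-insert : ∀ {n} (w : Fin n → ℕ) {i} {p : Subset n} → i ∉ p →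
  weightedSum w (⁅ i ⁆ ∪ p) ≡ w i + weightedSum w p
weightedSum-insert w {i} {p} i∉p =
  trans (weightedSum-∪ w disjoint) (cong (_+ weightedSum w p) (weightedSum-⁅⁆ w i))
  where
  disjoint : Empty (⁅ i ⁆ ∩ p)
  disjoint (j , j∈⁅i⁆∩p) with x∈p∩q⁻ ⁅ i ⁆ p j∈⁅i⁆∩p
  ... | j∈⁅i⁆ , j∈p = i∉p (subst (_∈ p) (x∈⁅y⁆⇒x≡y i j∈⁅i⁆) j∈p)

x∉p∧x∉q⇒x∉p∪q : ∀ {n} {x : Fin n} {p q} → x ∉ p → x ∉ q → x ∉ p ∪ q
x∉p∧x∉q⇒x∉p∪q {p = p} {q} x∉p x∉q x∈p∪q = [ x∉p , x∉q ]′ (x∈p∪q⁻ p q x∈p∪q)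

x∈p⇒⁅x⁆⊆p : ∀ {n} {x : Fin n} {p} → x ∈ p → ⁅ x ⁆ ⊆ p
x∈p⇒⁅x⁆⊆p {p = p} x∈p y∈⁅x⁆ = subst (_∈ p) (sym (x∈⁅y⁆⇒x≡y _ y∈⁅x⁆)) x∈p

∪-least : ∀ {n} {p q r : Subset n} → p ⊆ r → q ⊆ r → p ∪ q ⊆ r
∪-least {p = p} {q} p⊆r q⊆r x∈p∪q = [ p⊆r , q⊆r ]′ (x∈p∪q⁻ p q x∈p∪q)

weightedSum-⁅a,b,c,d⁆ : ∀ {n} (w : Fin n → ℕ) {a b c d} →
  toℕ a < toℕ b → toℕ b < toℕ c → toℕ c < toℕ d →
  weightedSum w (⁅ a ⁆ ∪ (⁅ b ⁆ ∪ (⁅ c ⁆ ∪ ⁅ d ⁆))) ≡ w a + (w b + (w c + w d))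
weightedSum-⁅a,b,c,d⁆ w {a} {b} {c} {d} a<b b<c c<d = begin
  weightedSum w (⁅ a ⁆ ∪ (⁅ b ⁆ ∪ (⁅ c ⁆ ∪ ⁅ d ⁆)))
    ≡⟨ weightedSum-insert w
         (x∉p∧x∉q⇒x∉p∪q (∉⁅⁆ a<b) (x∉p∧x∉q⇒x∉p∪q (∉⁅⁆ a<c) (∉⁅⁆ a<d))) ⟩
  w a + weightedSum w (⁅ b ⁆ ∪ (⁅ c ⁆ ∪ ⁅ d ⁆))
    ≡⟨ cong (w a +_) (weightedSum-insert w (x∉p∧x∉q⇒x∉p∪q (∉⁅⁆ b<c) (∉⁅⁆ b<d))) ⟩
  w a + (w b + weightedSum w (⁅ c ⁆ ∪ ⁅ d ⁆))
    ≡⟨ cong (λ x → w a + (w b + x)) (weightedSum-insert w (∉⁅⁆ c<d)) ⟩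
  w a + (w b + (w c + weightedSum w ⁅ d ⁆))
    ≡⟨ cong (λ x → w a + (w b + (w c + x))) (weightedSum-⁅⁆ w d) ⟩
  w a + (w b + (w c + w d)) ∎
  where
  open ≡-Reasoning
  ∉⁅⁆ : ∀ {x y} → toℕ x < toℕ y → x ∉ ⁅ y ⁆
  ∉⁅⁆ x<y = x≢y⇒x∉⁅y⁆ (Fin.<⇒≢ x<y)
  a<c = <-trans a<b b<c
  b<d = <-trans b<c c<d
  a<d = <-trans a<c c<d

fourElementSubset : ∀ {n} {S : Subset n} {a b c d} →
  toℕ a < toℕ b → toℕ b < toℕ c → toℕ c < toℕ d →
  a ∈ S → b ∈ S → c ∈ S → d ∈ S →
  Σ (Subset n) λ T → T ⊆ S × ∣ T ∣ ≡ 4 × subsetSum T ≡ toℕ a + (toℕ b + (toℕ c + toℕ d))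
fourElementSubset {a = a} {b} {c} {d} a<b b<c c<d a∈S b∈S c∈S d∈S =
  T , T⊆S , trans (∣p∣≡weightedSum T) (weightedSum-⁅a,b,c,d⁆ (λ _ → 1) a<b b<c c<d)
          , weightedSum-⁅a,b,c,d⁆ toℕ a<b b<c c<d
  where
  T = ⁅ a ⁆ ∪ (⁅ b ⁆ ∪ (⁅ c ⁆ ∪ ⁅ d ⁆))
  T⊆S = ∪-least (x∈p⇒⁅x⁆⊆p a∈S)
          (∪-least (x∈p⇒⁅x⁆⊆p b∈S) (∪-least (x∈p⇒⁅x⁆⊆p c∈S) (x∈p⇒⁅x⁆⊆p d∈S)))

interval : ∀ {n} → ℕ → ℕ → Subset n
interval {zero}  _       _       = []
interval {suc n} zero    zero    = ⊥
interval {suc n} zero    (suc k) = inside ∷ interval 0 k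
interval {suc n} (suc x) k       = outside ∷ interval x k

∣interval∣ : ∀ {n} x k → x + k ≤ n → ∣ interval {n} x k ∣ ≡ k
∣interval∣ {zero}  zero    zero    _       = refl
∣interval∣ {suc n} zero    zero    _       = ∣⊥∣≡0 (suc n)
∣interval∣ {suc n} zero    (suc k) (s≤s h) = cong suc (∣interval∣ 0 k h)
∣interval∣ {suc n} (suc x) k       (s≤s h) = ∣interval∣ x k h

∈interval : ∀ {n} {i : Fin n} x k → i ∈ interval x k → x ≤ toℕ i × toℕ i < x + k
∈interval {suc n} zero    zero    i∈⊥         = contradiction i∈⊥ ∉⊥
∈interval {suc n} zero    (suc k) here        = z≤n , s≤s z≤n
∈interval {suc n} zero    (suc k) (there i∈I) = z≤n , s≤s (proj₂ (∈interval 0 k i∈I))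
∈interval {suc n} (suc x) k       (there i∈I) = map s≤s s≤s (∈interval x k i∈I)

[1+n]C2≡n+nC2 : ∀ n → suc n C 2 ≡ n + n C 2
[1+n]C2≡n+nC2 n = trans (sym (nCk+nC[k+1]≡[n+1]C[k+1] n 1)) (cong (_+ n C 2) (nC1≡n n))

∣p∣≤bound : ∀ {n} z (T : Subset n) → (∀ {i} → i ∈ T → toℕ i < z) → ∣ T ∣ ≤ z
∣p∣≤bound z       []            _ = z≤n
∣p∣≤bound z       (outside ∷ T) h = ∣p∣≤bound z T (λ i∈T → <-trans (n<1+n _) (h (there i∈T)))
∣p∣≤bound zero    (inside ∷ T)  h = contradiction (h here) n≮0
∣p∣≤bound (suc z) (inside ∷ T)  h = s≤s (∣p∣≤bound z T (λ i∈T → s<s⁻¹ (h (there i∈T))))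

subsetSum≥lowerBound : ∀ {n} x (T : Subset n) → (∀ {i} → i ∈ T → x ≤ toℕ i) →
  x * ∣ T ∣ + ∣ T ∣ C 2 ≤ subsetSum T
subsetSum≥lowerBound x       []            _ = ≤-reflexive (trans (+-identityʳ (x * 0)) (*-zeroʳ x))
subsetSum≥lowerBound zero    (inside ∷ T)  h = begin
  suc ∣ T ∣ C 2        ≡⟨ [1+n]C2≡n+nC2 ∣ T ∣ ⟩
  ∣ T ∣ + ∣ T ∣ C 2    ≤⟨ +-monoʳ-≤ ∣ T ∣ (subsetSum≥lowerBound 0 T (λ _ → z≤n)) ⟩
  ∣ T ∣ + subsetSum T  ≡⟨ subsetSum-∷ inside T ⟨
  subsetSum (inside ∷ T) ∎
  where open ≤-Reasoning
subsetSum≥lowerBound (suc x) (inside ∷ T)  h = contradiction (h here) λ ()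
subsetSum≥lowerBound zero    (outside ∷ T) h = begin
  ∣ T ∣ C 2            ≤⟨ subsetSum≥lowerBound 0 T (λ _ → z≤n) ⟩
  subsetSum T          ≤⟨ m≤n+m (subsetSum T) ∣ T ∣ ⟩
  ∣ T ∣ + subsetSum T  ≡⟨ subsetSum-∷ outside T ⟨
  subsetSum (outside ∷ T) ∎
  where open ≤-Reasoning
subsetSum≥lowerBound (suc x) (outside ∷ T) h = begin
  (∣ T ∣ + x * ∣ T ∣) + ∣ T ∣ C 2  ≡⟨ +-assoc ∣ T ∣ (x * ∣ T ∣) (∣ T ∣ C 2) ⟩
  ∣ T ∣ + (x * ∣ T ∣ + ∣ T ∣ C 2)  ≤⟨ +-monoʳ-≤ ∣ T ∣ (subsetSum≥lowerBound x T h′) ⟩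
  ∣ T ∣ + subsetSum T              ≡⟨ subsetSum-∷ outside T ⟨
  subsetSum (outside ∷ T) ∎
  where
  open ≤-Reasoning
  h′ : ∀ {i} → i ∈ T → x ≤ toℕ i
  h′ i∈T = s≤s⁻¹ (h (there i∈T))

subsetSum≤upperBound : ∀ {n} z (T : Subset n) → (∀ {i} → i ∈ T → toℕ i < z) →
  subsetSum T + suc ∣ T ∣ C 2 ≤ z * ∣ T ∣
subsetSum≤upperBound z       []            _ = z≤n
subsetSum≤upperBound zero    (inside ∷ T)  h = contradiction (h here) n≮0
subsetSum≤upperBound zero    (outside ∷ T) h = begin
  subsetSum (outside ∷ T) + suc ∣ T ∣ C 2
    ≡⟨ cong (_+ suc ∣ T ∣ C 2) (trans (subsetSum-∷ outside T) (cong (_+ subsetSum T) ∣T∣≡0)) ⟩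
  subsetSum T + suc ∣ T ∣ C 2
    ≤⟨ subsetSum≤upperBound 0 T h′ ⟩
  0 ∎
  where
  open ≤-Reasoning
  h′ : ∀ {i} → i ∈ T → toℕ i < 0
  h′ i∈T = <-trans (n<1+n _) (h (there i∈T))
  ∣T∣≡0 : ∣ T ∣ ≡ 0
  ∣T∣≡0 = n≤0⇒n≡0 (∣p∣≤bound 0 T h′)
subsetSum≤upperBound (suc z) (outside ∷ T) h = begin
  subsetSum (outside ∷ T) + suc ∣ T ∣ C 2  ≡⟨ cong (_+ suc ∣ T ∣ C 2) (subsetSum-∷ outside T) ⟩
  (∣ T ∣ + subsetSum T) + suc ∣ T ∣ C 2    ≡⟨ +-assoc ∣ T ∣ (subsetSum T) (suc ∣ T ∣ C 2) ⟩
  ∣ T ∣ + (subsetSum T + suc ∣ T ∣ C 2)    ≤⟨ +-monoʳ-≤ ∣ T ∣ (subsetSum≤upperBound z T h′) ⟩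
  ∣ T ∣ + z * ∣ T ∣                        ∎
  where
  open ≤-Reasoning
  h′ : ∀ {i} → i ∈ T → toℕ i < z
  h′ i∈T = s<s⁻¹ (h (there i∈T))
subsetSum≤upperBound (suc z) (inside ∷ T)  h = begin
  subsetSum (inside ∷ T) + suc (suc k) C 2
    ≡⟨ cong₂ _+_ (subsetSum-∷ inside T) ([1+n]C2≡n+nC2 (suc k)) ⟩
  (k + s) + (suc k + suc k C 2)
    ≡⟨ rearrange k s (suc k C 2) ⟩
  suc k + (k + (s + suc k C 2))
    ≤⟨ +-monoʳ-≤ (suc k) (+-mono-≤ (∣p∣≤bound z T h′) (subsetSum≤upperBound z T h′)) ⟩
  suc k + (z + z * k)
    ≡⟨ cong (suc k +_) (*-suc z k) ⟨
  suc k + z * suc k ∎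
  where
  open ≤-Reasoning
  k = ∣ T ∣
  s = subsetSum T
  h′ : ∀ {i} → i ∈ T → toℕ i < z
  h′ i∈T = s<s⁻¹ (h (there i∈T))
  rearrange : ∀ k s c → (k + s) + (suc k + c) ≡ suc k + (k + (s + c))
  rearrange = solve-∀

n<m<n+n⇒n∤m : ∀ {n m} → n < m → m < n + n → ¬ n ∣ m
n<m<n+n⇒n∤m     n<m _     (divides zero refl)          = n≮0 n<m
n<m<n+n⇒n∤m {n} n<m _     (divides (suc zero) refl)    = n≮n n (subst (n <_) (+-identityʳ n) n<m)
n<m<n+n⇒n∤m {n} _   m<n+n (divides (suc (suc q)) refl) =
  n≮n (n + n) (≤-<-trans (+-monoʳ-≤ n (m≤m+n n (q * n))) m<n+n)

interval-zeroSumFree : ∀ {n} x k → n < x * 4 + 6 → (x + k) * 4 < n + n + 10 →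
  ∀ T → T ⊆ interval {n} x k → ∣ T ∣ ≡ 4 → ¬ ZeroSum T
interval-zeroSumFree {n} x k n<4x+6 4[x+k]<2n+10 T T⊆I ∣T∣≡4 = n<m<n+n⇒n∤m n<ΣT ΣT<n+n
  where
  bounds : ∀ {i} → i ∈ T → x ≤ toℕ i × toℕ i < x + k
  bounds i∈T = ∈interval x k (T⊆I i∈T)
  n<ΣT : n < subsetSum T
  n<ΣT = <-≤-trans n<4x+6 (subst (λ c → x * c + c C 2 ≤ subsetSum T) ∣T∣≡4
           (subsetSum≥lowerBound x T (λ i∈T → proj₁ (bounds i∈T))))
  ΣT<n+n : subsetSum T < n + n
  ΣT<n+n = +-cancelʳ-< 10 (subsetSum T) (n + n) (≤-<-trans
             (subst (λ c → subsetSum T + suc c C 2 ≤ (x + k) * c) ∣T∣≡4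
               (subsetSum≤upperBound (x + k) T (λ i∈T → proj₂ (bounds i∈T))))
             4[x+k]<2n+10)

HarborthProp⇒k<t : ∀ {n t} x k → x + k ≤ n → n < x * 4 + 6 → (x + k) * 4 < n + n + 10 →
  HarborthProp n 4 t → k < t
HarborthProp⇒k<t {t = t} x k fits low high prop with t ≤? k
... | no  t≰k = ≰⇒> t≰k
... | yes t≤k with prop (interval x k) (≤-trans t≤k (≤-reflexive (sym (∣interval∣ x k fits))))
...   | T , T⊆I , ∣T∣≡4 , zeroSum =
  contradiction zeroSum (interval-zeroSumFree x k low high T T⊆I ∣T∣≡4)

harborth-lowerBound : ∀ {t} k → 5 < k * 2 → HarborthProp (k * 2) 4 t → (k * 2 + 14 + 3) / 4 ≤ t
harborth-lowerBound k 5<2k prop with k / 2 | k % 2 | m≡m%n+[m/n]*n k 2 | m%n<n k 2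
... | zero  | zero        | refl | _ = contradiction 5<2k λ ()
... | zero  | suc zero    | refl | _ = contradiction 5<2k λ { (s≤s (s≤s ())) }
... | zero  | suc (suc _) | _    | s≤s (s≤s ())
... | suc r | e           | refl | e<2 =
  ≤-trans (s≤s⁻¹ (m<n*o⇒m/o<n (≤-trans (≤-reflexive (bound-eq r e)) ceil-bound)))
    (HarborthProp⇒k<t (r + e) (r + 4)
      (m+n≤o⇒m≤o _ (≤-reflexive (fits-eq r e)))
      (m+n≤o⇒m≤o _ (≤-reflexive (low-eq r e)))
      (m+n≤o⇒m≤o _ (≤-reflexive (high-eq r e)))
      prop)
  where
  fits-eq : ∀ r e → (r + e) + (r + 4) + (e + r * 2) ≡ (e + suc r * 2) * 2
  fits-eq = solve-∀
  low-eq : ∀ r e → suc ((e + suc r * 2) * 2) + (e * 2 + 1) ≡ (r + e) * 4 + 6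
  low-eq = solve-∀
  high-eq : ∀ r e → suc ((r + e + (r + 4)) * 4) + 1 ≡ (e + suc r * 2) * 2 + (e + suc r * 2) * 2 + 10
  high-eq = solve-∀
  bound-eq : ∀ r e → suc ((e + suc r * 2) * 2 + 14 + 3) ≡ e * 2 + (r * 4 + 22)
  bound-eq = solve-∀
  ceil-eq : ∀ r → 1 * 2 + (r * 4 + 22) ≡ suc (suc (r + 4)) * 4
  ceil-eq = solve-∀
  ceil-bound : e * 2 + (r * 4 + 22) ≤ suc (suc (r + 4)) * 4
  ceil-bound = ≤-trans (+-monoˡ-≤ (r * 4 + 22) (*-monoˡ-≤ 2 (s≤s⁻¹ e<2))) (≤-reflexive (ceil-eq r))

∣x∷p∣≤1+∣p∣ : ∀ {n} x (p : Subset n) → ∣ x ∷ p ∣ ≤ suc ∣ p ∣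
∣x∷p∣≤1+∣p∣ inside  p = ≤-refl
∣x∷p∣≤1+∣p∣ outside p = n≤1+n ∣ p ∣

∣p∷ʳx∣≡∣x∷p∣ : ∀ {n} (p : Subset n) x → ∣ p ∷ʳ x ∣ ≡ ∣ x ∷ p ∣
∣p∷ʳx∣≡∣x∷p∣ []            x       = refl
∣p∷ʳx∣≡∣x∷p∣ (inside ∷ p)  inside  = cong suc (∣p∷ʳx∣≡∣x∷p∣ p inside)
∣p∷ʳx∣≡∣x∷p∣ (inside ∷ p)  outside = cong suc (∣p∷ʳx∣≡∣x∷p∣ p outside)
∣p∷ʳx∣≡∣x∷p∣ (outside ∷ p) x       = ∣p∷ʳx∣≡∣x∷p∣ p x

∣x∷[p∷ʳy]∣≡∣x∷y∷p∣ : ∀ {n} x (p : Subset n) y → ∣ x ∷ (p ∷ʳ y) ∣ ≡ ∣ x ∷ y ∷ p ∣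
∣x∷[p∷ʳy]∣≡∣x∷y∷p∣ inside  p y = cong suc (∣p∷ʳx∣≡∣x∷p∣ p y)
∣x∷[p∷ʳy]∣≡∣x∷y∷p∣ outside p y = ∣p∷ʳx∣≡∣x∷p∣ p y

inject₁-∈-∷ʳ : ∀ {n} {i : Fin n} {p : Subset n} x → i ∈ p → inject₁ i ∈ p ∷ʳ x
inject₁-∈-∷ʳ x here        = here
inject₁-∈-∷ʳ x (there i∈p) = there (inject₁-∈-∷ʳ x i∈p)

fromℕ-∈-∷ʳ : ∀ {n} (p : Subset n) → fromℕ n ∈ p ∷ʳ inside
fromℕ-∈-∷ʳ []      = here
fromℕ-∈-∷ʳ (x ∷ p) = there (fromℕ-∈-∷ʳ p)

-- For S = s₀ ∷ R ⊆ C_(2p+2), position i of R is the element i+1 of C_n, so a mirror pair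
-- of R is a pair {j, n−j} ⊆ S with j ≠ n−j.
record MirrorPair p (R : Subset (suc (p * 2))) : Set where
  field
    {lo hi} : Fin (suc (p * 2))
    lo<hi   : toℕ lo < toℕ hi
    lo+hi   : toℕ lo + toℕ hi ≡ p * 2
    lo∈R    : lo ∈ R
    hi∈R    : hi ∈ R
open MirrorPair

outerMirrorPair : ∀ {p} (M : Subset (suc (p * 2))) → MirrorPair (suc p) (inside ∷ (M ∷ʳ inside))
outerMirrorPair {p} M = record
  { lo<hi = s≤s z≤n
  ; lo+hi = cong suc (Fin.toℕ-fromℕ (suc (p * 2)))
  ; lo∈R  = here
  ; hi∈R  = there (fromℕ-∈-∷ʳ M)
  }

liftMirrorPair : ∀ {p} {M : Subset (suc (p * 2))} {a b} →
  MirrorPair p M → MirrorPair (suc p) (a ∷ (M ∷ʳ b))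
liftMirrorPair {b = b} P = record
  { lo<hi = s≤s (subst₂ _<_ (sym (Fin.toℕ-inject₁ (lo P))) (sym (Fin.toℕ-inject₁ (hi P))) (lo<hi P))
  ; lo+hi = cong suc (trans (+-suc _ _) (cong suc
              (trans (cong₂ _+_ (Fin.toℕ-inject₁ (lo P)) (Fin.toℕ-inject₁ (hi P))) (lo+hi P))))
  ; lo∈R  = there (inject₁-∈-∷ʳ b (lo∈R P))
  ; hi∈R  = there (inject₁-∈-∷ʳ b (hi∈R P))
  }

mirrorPair : ∀ p (R : Subset (suc (p * 2))) → 2 + p ≤ ∣ R ∣ → MirrorPair p R
mirrorPair zero    R       h = contradiction (≤-trans h (∣p∣≤n R)) λ { (s≤s ()) }
mirrorPair (suc p) (a ∷ R) h with initLast R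
... | M , b , refl = peel a b (subst (3 + p ≤_) (∣x∷[p∷ʳy]∣≡∣x∷y∷p∣ a M b) h)
  where
  peel : ∀ a b → 3 + p ≤ ∣ a ∷ b ∷ M ∣ → MirrorPair (suc p) (a ∷ (M ∷ʳ b))
  peel inside  inside  _ = outerMirrorPair M
  peel inside  outside h = liftMirrorPair (mirrorPair p M (s≤s⁻¹ h))
  peel outside inside  h = liftMirrorPair (mirrorPair p M (s≤s⁻¹ h))
  peel outside outside h = liftMirrorPair (mirrorPair p M (≤-trans (n≤1+n _) h))

record NestedMirrorPairs p (R : Subset (suc (p * 2))) : Set where
  field
    outer inner   : MirrorPair p R
    outer<inner   : toℕ (lo outer) < toℕ (lo inner)
open NestedMirrorPairs

inner<outer : ∀ {p R} (N : NestedMirrorPairs p R) → toℕ (hi (inner N)) < toℕ (hi (outer N))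
inner<outer N = +-cancelˡ-< (toℕ (lo (outer N))) _ _ (begin-strict
  toℕ (lo (outer N)) + toℕ (hi (inner N)) <⟨ +-monoˡ-< (toℕ (hi (inner N))) (outer<inner N) ⟩
  toℕ (lo (inner N)) + toℕ (hi (inner N)) ≡⟨ trans (lo+hi (inner N)) (sym (lo+hi (outer N))) ⟩
  toℕ (lo (outer N)) + toℕ (hi (outer N)) ∎)
  where open ≤-Reasoning

liftNestedMirrorPairs : ∀ {p} {M : Subset (suc (p * 2))} {a b} →
  NestedMirrorPairs p M → NestedMirrorPairs (suc p) (a ∷ (M ∷ʳ b))
liftNestedMirrorPairs N = record
  { outer       = liftMirrorPair (outer N)
  ; inner       = liftMirrorPair (inner N)
  ; outer<inner = s≤s (subst₂ _<_ (sym (Fin.toℕ-inject₁ (lo (outer N))))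
                                  (sym (Fin.toℕ-inject₁ (lo (inner N))))
                                  (outer<inner N))
  }

nestedMirrorPairs : ∀ p (R : Subset (suc (p * 2))) → 3 + p ≤ ∣ R ∣ → NestedMirrorPairs p R
nestedMirrorPairs zero    R       h = contradiction (≤-trans h (∣p∣≤n R)) λ { (s≤s ()) }
nestedMirrorPairs (suc p) (a ∷ R) h with initLast R
... | M , b , refl = peel a b (subst (4 + p ≤_) (∣x∷[p∷ʳy]∣≡∣x∷y∷p∣ a M b) h)
  where
  peel : ∀ a b → 4 + p ≤ ∣ a ∷ b ∷ M ∣ → NestedMirrorPairs (suc p) (a ∷ (M ∷ʳ b))
  peel inside  inside  h = record
    { outer       = outerMirrorPair M
    ; inner       = liftMirrorPair (mirrorPair p M (s≤s⁻¹ (s≤s⁻¹ h)))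
    ; outer<inner = s≤s z≤n
    }
  peel inside  outside h = liftNestedMirrorPairs (nestedMirrorPairs p M (s≤s⁻¹ h))
  peel outside inside  h = liftNestedMirrorPairs (nestedMirrorPairs p M (s≤s⁻¹ h))
  peel outside outside h = liftNestedMirrorPairs (nestedMirrorPairs p M (≤-trans (n≤1+n _) h))

sum-of-two-pairs : ∀ {m} a b c d → a + d ≡ m → b + c ≡ m →
  suc a + (suc b + (suc c + suc d)) ≡ 2 * suc (suc m)
sum-of-two-pairs a b c d refl b+c≡a+d = begin
  suc a + (suc b + (suc c + suc d))      ≡⟨ regroup a b c d ⟩
  suc (suc (a + d)) + suc (suc (b + c))  ≡⟨ cong (λ x → suc (suc (a + d)) + suc (suc x)) b+c≡a+d ⟩
  suc (suc (a + d)) + suc (suc (a + d))  ≡⟨ cong (suc (suc (a + d)) +_) (+-identityʳ _) ⟨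
  2 * suc (suc (a + d))                  ∎
  where
  open ≡-Reasoning
  regroup : ∀ a b c d → suc a + (suc b + (suc c + suc d)) ≡ suc (suc (a + d)) + suc (suc (b + c))
  regroup = solve-∀

nestedMirrorPairs⇒zeroSum4 : ∀ {p} {R : Subset (suc (p * 2))} s₀ → NestedMirrorPairs p R →
  Σ (Subset (suc p * 2)) λ T → T ⊆ s₀ ∷ R × ∣ T ∣ ≡ 4 × ZeroSum T
nestedMirrorPairs⇒zeroSum4 s₀ N =
  let T , T⊆S , ∣T∣≡4 , ΣT = fourElementSubset
        (s≤s (outer<inner N)) (s≤s (lo<hi (inner N))) (s≤s (inner<outer N))
        (there (lo∈R (outer N))) (there (lo∈R (inner N))) (there (hi∈R (inner N))) (there (hi∈R (outer N)))
  in T , T⊆S , ∣T∣≡4 , divides 2 (trans ΣT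
       (sum-of-two-pairs (toℕ (lo (outer N))) _ _ (toℕ (hi (outer N))) (lo+hi (outer N)) (lo+hi (inner N))))

harborth-upperBound : ∀ p → HarborthProp (suc p * 2) 4 (suc p + 3)
harborth-upperBound p (s₀ ∷ R) h = nestedMirrorPairs⇒zeroSum4 s₀ (nestedMirrorPairs p R 3+p≤∣R∣)
  where
  3+p≤∣R∣ : 3 + p ≤ ∣ R ∣
  3+p≤∣R∣ = subst (_≤ ∣ R ∣) (+-comm p 3) (s≤s⁻¹ (≤-trans h (∣x∷p∣≤1+∣p∣ s₀ R)))

proposition3p18 : (n : ℕ) → 2 ∣ n → 5 < n → (g : ℕ) → IsHarborthConstant n 4 g →
    (n + 14 + 3) / 4 ≤ g × g ≤ n / 2 + 3
proposition3p18 .(suc p * 2) (divides (suc p) refl) 5<n g (_ , harborth-g , minimal) =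
  harborth-lowerBound (suc p) 5<n harborth-g ,
  subst (λ m → g ≤ m + 3) (sym (m*n/n≡m (suc p) 2))
    (minimal (suc p + 3) (s≤s z≤n) (harborth-upperBound p))
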